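{- Let $(T_n)_{n\ge 0}$ be the Tribonacci sequence. The Diophantine equation $$(T_{n}-1)\cdots (T_{n+k-1}-1)\,(T_{n+k}+1) \cdots (T_{n+k+\ell-1}+1)=d\left(\frac{10^{m}-1}{9}\right)$$ has no solution in positive integers $n,k,\ell,m,d$ with $1\leq d\leq 9$ and $m\geq 2$.
   Context: The Tribonacci sequence is defined by $T_0=0$, $T_1=T_2=1$ and $T_{n+3}=T_{n+2}+T_{n+1}+T_n$ for all $n\ge 0$. The right-hand side $d(10^m-1)/9$ is the repdigit consisting of $m$ copies of the digit $d$. -}

module Defs where

open import Data.Nat using (ℕ; zero; suc; _+_; _*_; _∸_; _^_)
open import Data.Nat.DivMod using (_/_)

T : ℕ → ℕ
T 0 = 0
T 1 = 1
T 2 = 1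
T (suc (suc (suc n))) = T (suc (suc n)) + T (suc n) + T n

prodFrom : ℕ → ℕ → (ℕ → ℕ) → ℕ
prodFrom s zero f = 1
prodFrom s (suc len) f = f s * prodFrom (suc s) len f

-- (T_n - 1)...(T_{n+k-1} - 1)(T_{n+k} + 1)...(T_{n+k+l-1} + 1)
-- (T i ≥ 1 for i ≥ 1, so truncated subtraction is exact for n ≥ 1)
lhs : ℕ → ℕ → ℕ → ℕ
lhs n k l = prodFrom n k (λ i → T i ∸ 1) * prodFrom (n + k) l (λ i → T i + 1)

repdigit : ℕ → ℕ → ℕ
repdigit d m = d * ((10 ^ m ∸ 1) / 9)

-- Write R_m = (10^m − 1)/9, so that the right-hand side is d·R_m.  Since
-- T_{i+4} = T_i + 2(T_{i+1} + T_{i+2}), T_i is odd exactly when i ≡ 1, 2 (mod 4), and then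
-- both T_i − 1 and T_i + 1 are even; so as soon as k + ℓ ≥ 8 the left-hand side is divisible
-- by 16, whereas R_m ≡ 11, 15 or 7 (mod 16) for m ≥ 2 makes 16 ∤ d·R_m for 1 ≤ d ≤ 9.
-- The 21 shapes with k + ℓ ≤ 7 are handled modulo a single modulus M: the Tribonacci
-- sequence is periodic mod M, and R_m mod M is periodic from m = 4 on, so both sides take
-- explicitly enumerable residues, and a computation over one period shows they never meet.
module Submission where

open import Defs
open import Data.Nat using (ℕ; zero; suc; _+_; _*_; _∸_; _^_; _≤_; _<_; _≤ᵇ_; _≡ᵇ_; _≤?_; _<?_; s≤s; z≤n; z<s; NonZero)
open import Data.Nat.Properties
open import Data.Nat.DivMod
open import Data.Nat.Divisibility using (_∣_; divides; ∣m⇒∣m*n; ∣n⇒∣m*n; *-pres-∣; n∣m⇒m%n≡0; m%n≡0⇒n∣m)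
open import Data.Nat.GeneralisedArithmetic using (iterate)
open import Data.Nat.Tactic.RingSolver using (solve-∀)
open import Data.Bool.Base using (Bool; true; false; _∧_; _∨_; not) renaming (T to IsTrue)
open import Data.Bool.Properties using (T-∧; T-∨)
open import Data.Product using (_×_; _,_; proj₁; proj₂; ∃-syntax)
open import Data.Sum using (inj₁; inj₂)
open import Data.Unit using (tt)
open import Function.Bundles using (Equivalence)
open import Relation.Nullary using (¬_; yes; no; contradiction)
open import Relation.Binary.PropositionalEquality
open ≡-Reasoning

open Equivalence using (to; from)

prodFrom-+ : ∀ s a b (f : ℕ → ℕ) → prodFrom s (a + b) f ≡ prodFrom s a f * prodFrom (s + a) b f
prodFrom-+ s zero b f = begin
  prodFrom s b f            ≡⟨ cong (λ s′ → prodFrom s′ b f) (sym (+-identityʳ s)) ⟩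
  prodFrom (s + 0) b f      ≡⟨ sym (*-identityˡ _) ⟩
  1 * prodFrom (s + 0) b f  ∎
prodFrom-+ s (suc a) b f = begin
  f s * prodFrom (suc s) (a + b) f                          ≡⟨ cong (f s *_) (prodFrom-+ (suc s) a b f) ⟩
  f s * (prodFrom (suc s) a f * prodFrom (suc s + a) b f)   ≡⟨ *-assoc (f s) _ _ ⟨
  f s * prodFrom (suc s) a f * prodFrom (suc s + a) b f     ≡⟨ cong (f s * prodFrom (suc s) a f *_) (cong (λ s′ → prodFrom s′ b f) (+-suc s a)) ⟨
  f s * prodFrom (suc s) a f * prodFrom (s + suc a) b f     ∎

prodFrom-shift : ∀ s i len (f : ℕ → ℕ) → prodFrom (s + i) len f ≡ prodFrom i len (λ j → f (s + j))
prodFrom-shift s i zero f = refl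
prodFrom-shift s i (suc len) f =
  cong (f (s + i) *_) (trans (cong (λ j → prodFrom j len f) (sym (+-suc s i))) (prodFrom-shift s (suc i) len f))

prodFrom-cong : ∀ s len {f g : ℕ → ℕ} → (∀ i → s ≤ i → i < s + len → f i ≡ g i) →
                prodFrom s len f ≡ prodFrom s len g
prodFrom-cong s zero eq = refl
prodFrom-cong s (suc len) eq = cong₂ _*_
  (eq s ≤-refl (m<m+n s z<s))
  (prodFrom-cong (suc s) len (λ i s<i i<s+len → eq i (<⇒≤ s<i) (subst (i <_) (sym (+-suc s len)) i<s+len)))

glue : ℕ → (ℕ → ℕ) → (ℕ → ℕ) → ℕ → ℕ
glue c f g i with i <? c
... | yes _ = f i
... | no _  = g i

glue-< : ∀ {c f g i} → i < c → glue c f g i ≡ f i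
glue-< {c} {i = i} i<c with i <? c
... | yes _  = refl
... | no i≮c = contradiction i<c i≮c

glue-≥ : ∀ {c f g i} → c ≤ i → glue c f g i ≡ g i
glue-≥ {c} {i = i} c≤i with i <? c
... | yes i<c = contradiction c≤i (<⇒≱ i<c)
... | no _    = refl

prodFrom-glue : ∀ s a b (f g : ℕ → ℕ) →
                prodFrom s a f * prodFrom (s + a) b g ≡ prodFrom s (a + b) (glue (s + a) f g)
prodFrom-glue s a b f g = sym (trans (prodFrom-+ s a b _)
  (cong₂ _*_ (prodFrom-cong s a (λ _ _ i<s+a → glue-< i<s+a))
             (prodFrom-cong (s + a) b (λ _ s+a≤i _ → glue-≥ s+a≤i))))

%-*ˡ-cong : ∀ q .{{_ : NonZero q}} a {x y} → x % q ≡ y % q → (a * x) % q ≡ (a * y) % q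
%-*ˡ-cong q a {x} {y} eq = begin
  (a * x) % q                ≡⟨ %-distribˡ-* a x q ⟩
  ((a % q) * (x % q)) % q    ≡⟨ cong (λ z → ((a % q) * z) % q) eq ⟩
  ((a % q) * (y % q)) % q    ≡⟨ %-distribˡ-* a y q ⟨
  (a * y) % q                ∎

%-*ʳ-cong : ∀ q .{{_ : NonZero q}} a {x y} → x % q ≡ y % q → (x * a) % q ≡ (y * a) % q
%-*ʳ-cong q a {x} {y} eq = trans (cong (_% q) (*-comm x a)) (trans (%-*ˡ-cong q a eq) (cong (_% q) (*-comm a y)))

[m%n+o]%n≡[m+o]%n : ∀ m o n .{{_ : NonZero n}} → (m % n + o) % n ≡ (m + o) % n
[m%n+o]%n≡[m+o]%n m o n = begin
  (m % n + o) % n          ≡⟨ %-distribˡ-+ (m % n) o n ⟩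
  (m % n % n + o % n) % n  ≡⟨ cong (λ x → (x + o % n) % n) (m%n%n≡m%n m n) ⟩
  (m % n + o % n) % n      ≡⟨ %-distribˡ-+ m o n ⟨
  (m + o) % n              ∎

%-distribˡ-+₃ : ∀ q .{{_ : NonZero q}} a b c → (a % q + b % q + c % q) % q ≡ (a + b + c) % q
%-distribˡ-+₃ q a b c = begin
  (a % q + b % q + c % q) % q          ≡⟨ %-distribˡ-+ (a % q + b % q) (c % q) q ⟩
  ((a % q + b % q) % q + c % q % q) % q ≡⟨ cong₂ (λ x y → (x + y) % q) (%-distribˡ-+ a b q) (sym (m%n%n≡m%n c q)) ⟨
  ((a + b) % q + c % q) % q            ≡⟨ %-distribˡ-+ (a + b) c q ⟨
  (a + b + c) % q                      ∎

%-affine-cong : ∀ q .{{_ : NonZero q}} a b {x y} → x % q ≡ y % q → (x * a + b) % q ≡ (y * a + b) % q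
%-affine-cong q a b {x} {y} eq = begin
  (x * a + b) % q                  ≡⟨ %-distribˡ-+ (x * a) b q ⟩
  ((x * a) % q + b % q) % q        ≡⟨ cong (λ z → (z + b % q) % q) (%-*ʳ-cong q a eq) ⟩
  ((y * a) % q + b % q) % q        ≡⟨ %-distribˡ-+ (y * a) b q ⟨
  (y * a + b) % q                  ∎

%-pred : ∀ q .{{_ : NonZero q}} x → 1 ≤ x → (x % q + (q ∸ 1)) % q ≡ (x ∸ 1) % q
%-pred q (suc x) _ = begin
  (suc x % q + (q ∸ 1)) % q  ≡⟨ [m%n+o]%n≡[m+o]%n (suc x) (q ∸ 1) q ⟩
  (suc x + (q ∸ 1)) % q      ≡⟨ cong (_% q) (trans (sym (+-suc x (q ∸ 1))) (cong (x +_) (suc-pred q))) ⟩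
  (x + q) % q                ≡⟨ [m+n]%n≡m%n x q ⟩
  x % q                      ∎

%-accumulate : ∀ q .{{_ : NonZero q}} acc {x y} z → x % q ≡ y % q → ((acc * x) % q * z) % q ≡ (acc * (y * z)) % q
%-accumulate q acc {x} {y} z x≡y = begin
  ((acc * x) % q * z) % q              ≡⟨ %-distribˡ-* ((acc * x) % q) z q ⟩
  ((acc * x) % q % q * (z % q)) % q    ≡⟨ cong (λ w → (w * (z % q)) % q) (m%n%n≡m%n (acc * x) q) ⟩
  ((acc * x) % q * (z % q)) % q        ≡⟨ %-distribˡ-* (acc * x) z q ⟨
  (acc * x * z) % q                    ≡⟨ cong (_% q) (*-assoc acc x z) ⟩
  (acc * (x * z)) % q                  ≡⟨ %-*ˡ-cong q acc (%-*ʳ-cong q z x≡y) ⟩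
  (acc * (y * z)) % q                  ∎

T-pos : ∀ n → 1 ≤ T (suc n)
T-pos zero          = s≤s z≤n
T-pos (suc zero)    = s≤s z≤n
T-pos (suc (suc n)) = ≤-trans (T-pos (suc n)) (≤-trans (m≤m+n _ (T (suc n))) (m≤m+n _ (T n)))

lhs-zero : ∀ n l → lhs n 0 l ≡ prodFrom n l (λ i → T i + 1)
lhs-zero n l = trans (*-identityˡ _) (cong (λ s → prodFrom s l (λ i → T i + 1)) (+-identityʳ n))

lhs-suc : ∀ n k l → lhs n (suc k) l ≡ (T n ∸ 1) * lhs (suc n) k l
lhs-suc n k l = begin
  (T n ∸ 1) * prodFrom (suc n) k f * prodFrom (n + suc k) l g    ≡⟨ cong ((T n ∸ 1) * prodFrom (suc n) k f *_) (cong (λ s → prodFrom s l g) (+-suc n k)) ⟩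
  (T n ∸ 1) * prodFrom (suc n) k f * prodFrom (suc n + k) l g    ≡⟨ *-assoc (T n ∸ 1) _ _ ⟩
  (T n ∸ 1) * (prodFrom (suc n) k f * prodFrom (suc n + k) l g)  ∎
  where
  f g : ℕ → ℕ
  f i = T i ∸ 1
  g i = T i + 1

T-parity-period : ∀ n → T (4 + n) % 2 ≡ T n % 2
T-parity-period n = trans (cong (_% 2) (rearrange (T n) (T (1 + n)) (T (2 + n))))
                          ([m+kn]%n≡m%n (T n) (T (1 + n) + T (2 + n)) 2)
  where
  rearrange : ∀ a b c → c + b + a + c + b ≡ a + (b + c) * 2
  rearrange = solve-∀

EvenAtOddT : (ℕ → ℕ) → Set
EvenAtOddT f = ∀ i → T i % 2 ≡ 1 → 2 ∣ f i

glue-even : ∀ c {f g} → EvenAtOddT f → EvenAtOddT g → EvenAtOddT (glue c f g)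
glue-even c ef eg i odd with i <? c
... | yes _ = ef i odd
... | no _  = eg i odd

odd⇒2∣∸1 : ∀ x → x % 2 ≡ 1 → 2 ∣ x ∸ 1
odd⇒2∣∸1 x odd = divides (x / 2) (cong (_∸ 1) (trans (m≡m%n+[m/n]*n x 2) (cong (_+ x / 2 * 2) odd)))

odd⇒2∣+1 : ∀ x → x % 2 ≡ 1 → 2 ∣ x + 1
odd⇒2∣+1 x odd = divides (suc (x / 2)) (begin
  x + 1                  ≡⟨ cong (_+ 1) (trans (m≡m%n+[m/n]*n x 2) (cong (_+ x / 2 * 2) odd)) ⟩
  1 + x / 2 * 2 + 1      ≡⟨ +-comm (1 + x / 2 * 2) 1 ⟩
  suc (x / 2) * 2        ∎)

4∣prodFrom-4 : ∀ {h} → EvenAtOddT h → ∀ i → 4 ∣ prodFrom i 4 h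
4∣prodFrom-4 {h} even 0 = ∣n⇒∣m*n (h 0) (*-pres-∣ (even 1 refl) (∣m⇒∣m*n _ (even 2 refl)))
4∣prodFrom-4 {h} even 1 = *-pres-∣ (even 1 refl) (∣m⇒∣m*n _ (even 2 refl))
4∣prodFrom-4 {h} even 2 = *-pres-∣ (even 2 refl) (∣n⇒∣m*n (h 3) (∣n⇒∣m*n (h 4) (∣m⇒∣m*n 1 (even 5 refl))))
4∣prodFrom-4 {h} even 3 = ∣n⇒∣m*n (h 3) (∣n⇒∣m*n (h 4) (*-pres-∣ (even 5 refl) (∣m⇒∣m*n 1 (even 6 refl))))
4∣prodFrom-4 {h} even (suc (suc (suc (suc i)))) = subst (4 ∣_) (sym (prodFrom-shift 4 i 4 h))
  (4∣prodFrom-4 (λ j odd → even (4 + j) (trans (T-parity-period j) odd)) i)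

16∣prodFrom-8+ : ∀ {h} → EvenAtOddT h → ∀ i r → 16 ∣ prodFrom i (8 + r) h
16∣prodFrom-8+ {h} even i r = subst (16 ∣_) (sym (prodFrom-+ i 4 (4 + r) h))
  (*-pres-∣ (4∣prodFrom-4 even i)
            (subst (4 ∣_) (sym (prodFrom-+ (i + 4) 4 r h)) (∣m⇒∣m*n _ (4∣prodFrom-4 even (i + 4)))))

16∣lhs : ∀ n k l → 8 ≤ k + l → 16 ∣ lhs n k l
16∣lhs n k l 8≤k+l with r , 8+r≡k+l ← m≤n⇒∃[o]m+o≡n 8≤k+l =
  subst (16 ∣_) (sym (prodFrom-glue n k l (λ i → T i ∸ 1) (λ i → T i + 1)))
    (subst (λ len → 16 ∣ prodFrom n len factor) 8+r≡k+l
      (16∣prodFrom-8+ (glue-even (n + k) (λ i → odd⇒2∣∸1 (T i)) (λ i → odd⇒2∣+1 (T i))) n r))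
  where
  factor : ℕ → ℕ
  factor = glue (n + k) (λ i → T i ∸ 1) (λ i → T i + 1)

repunit : ℕ → ℕ
repunit zero    = 0
repunit (suc m) = repunit m * 10 + 1

repunit-+ : ∀ a b → repunit (a + b) ≡ repunit a * 10 ^ b + repunit b
repunit-+ a zero = begin
  repunit (a + 0)          ≡⟨ cong repunit (+-identityʳ a) ⟩
  repunit a                ≡⟨ *-identityʳ (repunit a) ⟨
  repunit a * 1            ≡⟨ +-identityʳ (repunit a * 1) ⟨
  repunit a * 1 + 0        ∎
repunit-+ a (suc b) = begin
  repunit (a + suc b)                              ≡⟨ cong repunit (+-suc a b) ⟩
  repunit (a + b) * 10 + 1                         ≡⟨ cong (λ x → x * 10 + 1) (repunit-+ a b) ⟩
  (repunit a * 10 ^ b + repunit b) * 10 + 1        ≡⟨ rearrange (repunit a) (10 ^ b) (repunit b) ⟩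
  repunit a * (10 * 10 ^ b) + (repunit b * 10 + 1) ∎
  where
  rearrange : ∀ x y z → (x * y + z) * 10 + 1 ≡ x * (10 * y) + (z * 10 + 1)
  rearrange = solve-∀

10^≡repunit*9+1 : ∀ m → 10 ^ m ≡ repunit m * 9 + 1
10^≡repunit*9+1 zero    = refl
10^≡repunit*9+1 (suc m) = trans (cong (10 *_) (10^≡repunit*9+1 m)) (rearrange (repunit m))
  where
  rearrange : ∀ r → 10 * (r * 9 + 1) ≡ (r * 10 + 1) * 9 + 1
  rearrange = solve-∀

repdigit≡*repunit : ∀ d m → repdigit d m ≡ d * repunit m
repdigit≡*repunit d m = begin
  d * ((10 ^ m ∸ 1) / 9)              ≡⟨ cong (λ x → d * ((x ∸ 1) / 9)) (10^≡repunit*9+1 m) ⟩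
  d * ((repunit m * 9 + 1 ∸ 1) / 9)   ≡⟨ cong (λ x → d * (x / 9)) (m+n∸n≡m (repunit m * 9) 1) ⟩
  d * (repunit m * 9 / 9)             ≡⟨ cong (d *_) (m*n/n≡m (repunit m) 9) ⟩
  d * repunit m                       ∎

repunit-+-mod : ∀ q .{{_ : NonZero q}} a b → q ∣ repunit a * 10 ^ b → repunit (a + b) % q ≡ repunit b % q
repunit-+-mod q a b q∣ = trans (cong (_% q) (repunit-+ a b)) (%-remove-+ˡ (repunit b) q∣)

module _ (q : ℕ) .{{_ : NonZero q}} {p e : ℕ} (q∣ : q ∣ repunit p * 10 ^ e) where

  repunit-period : ∀ {m} → e ≤ m → repunit (p + m) % q ≡ repunit m % q
  repunit-period e≤m with x , refl ← m≤n⇒∃[o]m+o≡n e≤m = repunit-+-mod q p (e + x) (subst (q ∣_) split (∣m⇒∣m*n (10 ^ x) q∣))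
    where
    split : repunit p * 10 ^ e * 10 ^ x ≡ repunit p * 10 ^ (e + x)
    split = trans (*-assoc (repunit p) _ _) (cong (repunit p *_) (sym (^-distribˡ-+-* 10 e x)))

  repunit-periodic : ∀ {m} → e ≤ m → ∀ t → repunit (t * p + m) % q ≡ repunit m % q
  repunit-periodic e≤m zero    = refl
  repunit-periodic {m} e≤m (suc t) = begin
    repunit (p + t * p + m) % q    ≡⟨ cong (λ x → repunit x % q) (+-assoc p (t * p) m) ⟩
    repunit (p + (t * p + m)) % q  ≡⟨ repunit-period (≤-trans e≤m (m≤n+m m (t * p))) ⟩
    repunit (t * p + m) % q        ≡⟨ repunit-periodic e≤m t ⟩
    repunit m % q                  ∎

  repunit-reduce : .{{_ : NonZero p}} → ∀ {b m} → b ≤ e → b ≤ m →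
                   ∃[ j ] j < e ∸ b + p × repunit m % q ≡ repunit (b + j) % q
  repunit-reduce {b} {m} b≤e b≤m with m <? e
  ... | yes m<e = m ∸ b , <-≤-trans (∸-monoˡ-< m<e b≤m) (m≤m+n (e ∸ b) p) ,
                  cong (λ x → repunit x % q) (sym (m+[n∸m]≡n b≤m))
  ... | no m≮e with x , refl ← m≤n⇒∃[o]m+o≡n (≮⇒≥ m≮e) =
    e ∸ b + x % p , +-monoʳ-< (e ∸ b) (m%n<n x p) , (begin
      repunit (e + x) % q                    ≡⟨ cong (λ y → repunit y % q) split ⟩
      repunit (x / p * p + (e + x % p)) % q  ≡⟨ repunit-periodic (m≤m+n e (x % p)) (x / p) ⟩
      repunit (e + x % p) % q                ≡⟨ cong (λ y → repunit y % q) shift ⟨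
      repunit (b + (e ∸ b + x % p)) % q      ∎)
    where
    rearrange : ∀ e r s → e + (r + s) ≡ s + (e + r)
    rearrange = solve-∀
    split : e + x ≡ x / p * p + (e + x % p)
    split = trans (cong (e +_) (m≡m%n+[m/n]*n x p)) (rearrange e (x % p) (x / p * p))
    shift : b + (e ∸ b + x % p) ≡ e + x % p
    shift = trans (sym (+-assoc b (e ∸ b) (x % p))) (cong (_+ x % p) (m+[n∸m]≡n b≤e))

module RepdigitResidues (q : ℕ) .{{_ : NonZero q}} where

  scan : (d v f ρ : ℕ) → Bool
  scan d v zero    ρ = false
  scan d v (suc f) ρ = (v ≡ᵇ (d * ρ) % q) ∨ scan d v f ((ρ * 10 + 1) % q)

  scan-complete : ∀ d f {ρ} m j → ρ % q ≡ repunit m % q → j < f → IsTrue (scan d ((d * repunit (m + j)) % q) f ρ)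
  scan-complete d (suc f) m zero ρ≡ _ = from T-∨ (inj₁ (≡⇒≡ᵇ _ _
    (trans (cong (λ x → (d * repunit x) % q) (+-identityʳ m)) (%-*ˡ-cong q d (sym ρ≡)))))
  scan-complete d (suc f) {ρ} m (suc j) ρ≡ (s≤s j<f) = from T-∨ (inj₂
    (subst (λ x → IsTrue (scan d ((d * repunit x) % q) f ((ρ * 10 + 1) % q))) (sym (+-suc m j))
      (scan-complete d f (suc m) j (trans (m%n%n≡m%n (ρ * 10 + 1) q) (%-affine-cong q 10 1 ρ≡)) j<f)))

  isRepdigit : (f d v : ℕ) → Bool
  isRepdigit f d v = scan d v f (repunit 2 % q)

  isRepdigit-complete : ∀ p e → q ∣ repunit p * 10 ^ e → .{{_ : NonZero p}} → 2 ≤ e →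
                        ∀ d {m} → 2 ≤ m → IsTrue (isRepdigit (e ∸ 2 + p) d ((d * repunit m) % q))
  isRepdigit-complete p e q∣ 2≤e d 2≤m with j , j< , eq ← repunit-reduce q q∣ 2≤e 2≤m =
    subst (λ v → IsTrue (isRepdigit (e ∸ 2 + p) d v)) (%-*ˡ-cong q d (sym eq))
      (scan-complete d _ 2 j (m%n%n≡m%n (repunit 2) q) j<)

module TribonacciMod (q : ℕ) .{{_ : NonZero q}} where

  State : Set
  State = ℕ × ℕ × ℕ

  step : State → State
  step (a , b , c) = b , c , (a + b + c) % q

  tribState : ℕ → State
  tribState n = T n % q , T (1 + n) % q , T (2 + n) % q

  step-tribState : ∀ n → step (tribState n) ≡ tribState (suc n)
  step-tribState n = cong (λ x → T (1 + n) % q , T (2 + n) % q , x) (begin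
    (T n % q + T (1 + n) % q + T (2 + n) % q) % q  ≡⟨ %-distribˡ-+₃ q (T n) (T (1 + n)) (T (2 + n)) ⟩
    (T n + T (1 + n) + T (2 + n)) % q              ≡⟨ cong (_% q) (reverse (T n) (T (1 + n)) (T (2 + n))) ⟩
    T (3 + n) % q                                  ∎)
    where
    reverse : ∀ a b c → a + b + c ≡ c + b + a
    reverse = solve-∀

  iterate-tribState : ∀ r n → iterate step (tribState n) r ≡ tribState (r + n)
  iterate-tribState zero    n = refl
  iterate-tribState (suc r) n = begin
    iterate step (step (tribState n)) r  ≡⟨ cong (λ s → iterate step s r) (step-tribState n) ⟩
    iterate step (tribState (suc n)) r   ≡⟨ iterate-tribState r (suc n) ⟩
    tribState (r + suc n)                ≡⟨ cong tribState (+-suc r n) ⟩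
    tribState (suc r + n)                ∎

  allOnOrbit : (State → Bool) → ℕ → State → Bool
  allOnOrbit P zero    s = true
  allOnOrbit P (suc r) s = P s ∧ allOnOrbit P r (step s)

  allOnOrbit-sound : ∀ P r s → IsTrue (allOnOrbit P r s) → ∀ i → i < r → IsTrue (P (iterate step s i))
  allOnOrbit-sound P (suc r) s h zero    _         = proj₁ (to T-∧ h)
  allOnOrbit-sound P (suc r) s h (suc i) (s≤s i<r) = allOnOrbit-sound P r (step s) (proj₂ (to T-∧ h)) i i<r

  module _ {p : ℕ} .{{_ : NonZero p}} (period : iterate step (tribState 0) p ≡ tribState 0) where

    tribState-+period : ∀ n → tribState (n + p) ≡ tribState n
    tribState-+period n = begin
      tribState (n + p)              ≡⟨ iterate-tribState n p ⟨
      iterate step (tribState p) n   ≡⟨ cong (λ s → iterate step s n) tribState-p ⟩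
      iterate step (tribState 0) n   ≡⟨ iterate-tribState n 0 ⟩
      tribState (n + 0)              ≡⟨ cong tribState (+-identityʳ n) ⟩
      tribState n                    ∎
      where
      tribState-p : tribState p ≡ tribState 0
      tribState-p = trans (cong tribState (sym (+-identityʳ p))) (trans (sym (iterate-tribState p 0)) period)

    tribState-+*period : ∀ r t → tribState (r + t * p) ≡ tribState r
    tribState-+*period r zero    = cong tribState (+-identityʳ r)
    tribState-+*period r (suc t) = begin
      tribState (r + (p + t * p))  ≡⟨ cong tribState (rearrange r p (t * p)) ⟩
      tribState (r + t * p + p)    ≡⟨ tribState-+period (r + t * p) ⟩
      tribState (r + t * p)        ≡⟨ tribState-+*period r t ⟩
      tribState r                  ∎
      where
      rearrange : ∀ r p x → r + (p + x) ≡ r + x + p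
      rearrange = solve-∀

    allOnOrbit-everywhere : ∀ P → allOnOrbit P p (tribState 0) ≡ true → ∀ n → IsTrue (P (tribState n))
    allOnOrbit-everywhere P h n =
      subst (λ s → IsTrue (P s)) tribState-n (allOnOrbit-sound P p (tribState 0) (subst IsTrue (sym h) tt) (n % p) (m%n<n n p))
      where
      tribState-n : iterate step (tribState 0) (n % p) ≡ tribState n
      tribState-n = begin
        iterate step (tribState 0) (n % p)   ≡⟨ iterate-tribState (n % p) 0 ⟩
        tribState (n % p + 0)                ≡⟨ cong tribState (+-identityʳ (n % p)) ⟩
        tribState (n % p)                    ≡⟨ tribState-+*period (n % p) (n / p) ⟨
        tribState (n % p + n / p * p)        ≡⟨ cong tribState (m≡m%n+[m/n]*n n p) ⟨
        tribState n                          ∎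

  -- The chains share prefix products between the shapes; a + (q ∸ 1) stands for a − 1 modulo q.
  module Chains (bad : ℕ → Bool) where

    plusChain : ℕ → ℕ → State → Bool
    plusChain zero    acc s         = true
    plusChain (suc f) acc s@(a , _) = continue ((acc * (a + 1)) % q)
      where
      continue : ℕ → Bool
      continue v = not (bad v) ∧ plusChain f v (step s)

    minusChain : ℕ → ℕ → State → Bool
    minusChain zero    acc s         = true
    minusChain (suc f) acc s@(a , _) = continue ((acc * (a + (q ∸ 1))) % q) (step s)
      where
      continue : ℕ → State → Bool
      continue v s′ = plusChain f v s′ ∧ minusChain f v s′

    plusChain-sound : ∀ f acc n → IsTrue (plusChain f acc (tribState n)) →
                      ∀ l → 1 ≤ l → l ≤ f → IsTrue (not (bad ((acc * prodFrom n l (λ i → T i + 1)) % q)))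
    plusChain-sound (suc f) acc n h 1 _ _ = subst (λ x → IsTrue (not (bad x))) v≡ (proj₁ (to T-∧ h))
      where
      v≡ : (acc * (T n % q + 1)) % q ≡ (acc * ((T n + 1) * 1)) % q
      v≡ = trans (sym (trans (cong (_% q) (*-identityʳ _)) (m%n%n≡m%n _ q)))
                 (%-accumulate q acc 1 ([m%n+o]%n≡[m+o]%n (T n) 1 q))
    plusChain-sound (suc f) acc n h (suc (suc l)) _ (s≤s l<f) =
      subst (λ x → IsTrue (not (bad x))) (%-accumulate q acc _ ([m%n+o]%n≡[m+o]%n (T n) 1 q))
        (plusChain-sound f v (suc n) rest (suc l) (s≤s z≤n) l<f)
      where
      v = (acc * (T n % q + 1)) % q
      rest : IsTrue (plusChain f v (tribState (suc n)))
      rest = subst (λ s → IsTrue (plusChain f v s)) (step-tribState n) (proj₂ (to T-∧ h))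

    minusChain-sound : ∀ f acc n → 1 ≤ n → IsTrue (minusChain f acc (tribState n)) →
                       ∀ k l → 1 ≤ k → 1 ≤ l → k + l ≤ f → IsTrue (not (bad ((acc * lhs n k l) % q)))
    minusChain-sound (suc f) acc (suc n′) _ h (suc k) l _ 1≤l (s≤s k+l≤f) =
      subst (λ x → IsTrue (not (bad x))) v*lhs≡ (rest k k+l≤f)
      where
      n = suc n′
      v = (acc * (T n % q + (q ∸ 1))) % q
      v*lhs≡ : (v * lhs (suc n) k l) % q ≡ (acc * lhs n (suc k) l) % q
      v*lhs≡ = trans (%-accumulate q acc (lhs (suc n) k l) (%-pred q (T n) (T-pos n′)))
                     (cong (λ x → (acc * x) % q) (sym (lhs-suc n k l)))
      both = to T-∧ (subst (λ s → IsTrue (plusChain f v s ∧ minusChain f v s)) (step-tribState n) h)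
      rest : ∀ k → k + l ≤ f → IsTrue (not (bad ((v * lhs (suc n) k l) % q)))
      rest zero    l≤f   = subst (λ x → IsTrue (not (bad ((v * x) % q)))) (sym (lhs-zero (suc n) l))
                                   (plusChain-sound f v (suc n) (proj₁ both) l 1≤l l≤f)
      rest (suc k) k+l≤f = minusChain-sound f v (suc n) (s≤s z≤n) (proj₂ both) (suc k) l (s≤s z≤n) 1≤l k+l≤f

IsTrue-not : ∀ b → IsTrue (not b) → ¬ IsTrue b
IsTrue-not false _ ()
IsTrue-not true  ()

-- M = 2⁴·5²·7·13·17·41·61.  The Tribonacci sequence has period 104160 modulo M, and 10 has
-- order 240 modulo 7·13·17·41·61, whence M ∣ R₂₄₀·10⁴.
M : ℕ
M = 1547618800

open RepdigitResidues using (isRepdigit; isRepdigit-complete)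

-- For m ≥ 2, R_m ≡ 11 and 16·11 ≡ 1 (mod 25), so digitOf recovers d from d·R_m.
digitOf : ℕ → ℕ
digitOf v = (16 * v) % 25

digitOf-repdigit : ∀ q .{{_ : NonZero q}} → 25 ∣ q → ∀ {d m} → d ≤ 9 → 2 ≤ m → digitOf ((d * repunit m) % q) ≡ d
digitOf-repdigit q 25∣q {d} {m} d≤9 2≤m = begin
  (16 * ((d * repunit m) % q)) % 25   ≡⟨ %-*ˡ-cong 25 16 {(d * repunit m) % q} {d * repunit m}
                                           (m∣n⇒o%n%m≡o%m 25 q (d * repunit m) 25∣q) ⟩
  (16 * (d * repunit m)) % 25         ≡⟨ %-*ˡ-cong 25 16 {d * repunit m} {d * 11} (%-*ˡ-cong 25 d repunit≡11) ⟩
  (16 * (d * 11)) % 25                ≡⟨ cong (_% 25) (rearrange d) ⟩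
  (d + 7 * d * 25) % 25               ≡⟨ [m+kn]%n≡m%n d (7 * d) 25 ⟩
  d % 25                              ≡⟨ m≤n⇒m%n≡m (≤-trans d≤9 (m≤m+n 9 15)) ⟩
  d                                   ∎
  where
  rearrange : ∀ d → 16 * (d * 11) ≡ d + 7 * d * 25
  rearrange = solve-∀
  repunit≡11 : repunit m % 25 ≡ 11 % 25
  repunit≡11 = trans (cong (λ x → repunit x % 25) (sym (m∸n+n≡m 2≤m)))
                     (repunit-+-mod 25 (m ∸ 2) 2 (∣n⇒∣m*n (repunit (m ∸ 2)) (divides 4 refl)))

-- Modulo 16, R_m (m ≥ 2) is congruent to one of R₂, R₃, R₄; modulo M to one of R₂, …, R₂₄₃.
-- The test modulo 16 is implied by the one modulo M and only serves as a cheap filter.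
isRepdigitResidueWith : ℕ → ℕ → Bool
isRepdigitResidueWith d v = (1 ≤ᵇ d) ∧ (d ≤ᵇ 9) ∧ isRepdigit 16 3 d (v % 16) ∧ isRepdigit M 242 d v

isRepdigitResidue : ℕ → Bool
isRepdigitResidue v = isRepdigitResidueWith (digitOf v) v

16∣repunit[1]*10⁴ : 16 ∣ repunit 1 * 10 ^ 4
16∣repunit[1]*10⁴ = divides 625 refl

M∣repunit[240]*10⁴ : M ∣ repunit 240 * 10 ^ 4
M∣repunit[240]*10⁴ = m%n≡0⇒n∣m _ M refl

repdigit-isRepdigitResidue : ∀ d m → 1 ≤ d → d ≤ 9 → 2 ≤ m → IsTrue (isRepdigitResidue (repdigit d m % M))
repdigit-isRepdigitResidue d m 1≤d d≤9 2≤m =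
  subst (λ v → IsTrue (isRepdigitResidue (v % M))) (sym (repdigit≡*repunit d m))
    (subst (λ d′ → IsTrue (isRepdigitResidueWith d′ v)) (sym (digitOf-repdigit M (divides 61904752 refl) d≤9 2≤m))
      (from T-∧ (≤⇒≤ᵇ 1≤d , from T-∧ (≤⇒≤ᵇ d≤9 , from T-∧ (mod16 , modM)))))
  where
  v = (d * repunit m) % M
  mod16 : IsTrue (isRepdigit 16 3 d (v % 16))
  mod16 = subst (λ x → IsTrue (isRepdigit 16 3 d x)) (sym (m∣n⇒o%n%m≡o%m 16 M (d * repunit m) (divides 96726175 refl)))
            (isRepdigit-complete 16 1 4 16∣repunit[1]*10⁴ (s≤s (s≤s z≤n)) d 2≤m)
  modM : IsTrue (isRepdigit M 242 d v)
  modM = isRepdigit-complete M 240 4 M∣repunit[240]*10⁴ (s≤s (s≤s z≤n)) d 2≤m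

0-not-repdigit-mod-16 : ∀ d → 1 ≤ d → d ≤ 9 → ¬ IsTrue (isRepdigit 16 3 d 0)
0-not-repdigit-mod-16 1 _ _ ()
0-not-repdigit-mod-16 2 _ _ ()
0-not-repdigit-mod-16 3 _ _ ()
0-not-repdigit-mod-16 4 _ _ ()
0-not-repdigit-mod-16 5 _ _ ()
0-not-repdigit-mod-16 6 _ _ ()
0-not-repdigit-mod-16 7 _ _ ()
0-not-repdigit-mod-16 8 _ _ ()
0-not-repdigit-mod-16 9 _ _ ()
0-not-repdigit-mod-16 (suc (suc (suc (suc (suc (suc (suc (suc (suc (suc _)))))))))) _
  (s≤s (s≤s (s≤s (s≤s (s≤s (s≤s (s≤s (s≤s (s≤s ()))))))))) _

16∤repdigit : ∀ d m → 1 ≤ d → d ≤ 9 → 2 ≤ m → ¬ 16 ∣ repdigit d m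
16∤repdigit d m 1≤d d≤9 2≤m 16∣ = 0-not-repdigit-mod-16 d 1≤d d≤9
  (subst (λ v → IsTrue (isRepdigit 16 3 d v)) (n∣m⇒m%n≡0 _ 16 (subst (16 ∣_) (repdigit≡*repunit d m) 16∣))
    (isRepdigit-complete 16 1 4 16∣repunit[1]*10⁴ (s≤s (s≤s z≤n)) d 2≤m))

open TribonacciMod using (step; tribState; allOnOrbit; allOnOrbit-everywhere)
open TribonacciMod.Chains using (minusChain; minusChain-sound)

period-M : iterate (step M) (tribState M 0) 104160 ≡ tribState M 0
period-M = refl

sieve-M : allOnOrbit M (minusChain M isRepdigitResidue 7 1) 104160 (tribState M 0) ≡ true
sieve-M = refl

lhs-not-repdigitResidue : ∀ n k l → 1 ≤ n → 1 ≤ k → 1 ≤ l → k + l ≤ 7 →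
                          ¬ IsTrue (isRepdigitResidue (lhs n k l % M))
lhs-not-repdigitResidue n k l 1≤n 1≤k 1≤l k+l≤7 = IsTrue-not (isRepdigitResidue (lhs n k l % M))
  (subst (λ x → IsTrue (not (isRepdigitResidue (x % M)))) (*-identityˡ (lhs n k l))
    (minusChain-sound M isRepdigitResidue 7 1 n 1≤n
      (allOnOrbit-everywhere M {p = 104160} period-M (minusChain M isRepdigitResidue 7 1) sieve-M n) k l 1≤k 1≤l k+l≤7))

theorem3 : (n k l m d : ℕ) → 1 ≤ n → 1 ≤ k → 1 ≤ l → 2 ≤ m → 1 ≤ d → d ≤ 9 →
    lhs n k l ≢ repdigit d m
theorem3 n k l m d 1≤n 1≤k 1≤l 2≤m 1≤d d≤9 lhs≡repdigit with k + l ≤? 7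
... | yes k+l≤7 = lhs-not-repdigitResidue n k l 1≤n 1≤k 1≤l k+l≤7
                    (subst (λ x → IsTrue (isRepdigitResidue (x % M))) (sym lhs≡repdigit)
                           (repdigit-isRepdigitResidue d m 1≤d d≤9 2≤m))
... | no k+l≰7  = 16∤repdigit d m 1≤d d≤9 2≤m (subst (16 ∣_) lhs≡repdigit (16∣lhs n k l (≰⇒> k+l≰7)))
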